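{- Let $p$ be a prime and $D$ a discriminant form of level a power of $p$. If there exists an isotropic subgroup $H\subset D$ isomorphic to $(\mathbb Z/p\mathbb Z)^3$, then for every $\gamma\in D$ the group $\gamma^\perp$ contains an isotropic subgroup isomorphic to $(\mathbb Z/p\mathbb Z)^2$.
   Context: A discriminant form is a finite abelian group $D$ with a quadratic form $\operatorname{q}:D\to\mathbb Q/\mathbb Z$ whose bilinear form $(\beta,\gamma)=\operatorname{q}(\beta+\gamma)-\operatorname{q}(\beta)-\operatorname{q}(\gamma)\bmod1$ is non-degenerate; level is the least $N>0$ with $N\operatorname{q}\equiv0$. A subgroup is isotropic if $\operatorname{q}$ vanishes on it; $\gamma^\perp=\{\beta\in D:(\beta,\gamma)=0\bmod1\}$. -}

module Defs where

open import Level using (Level; _⊔_) renaming (suc to lsuc)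
open import Data.Nat as ℕ using (ℕ; zero; suc; _<_; _≤_)
open import Data.Integer as ℤ using (ℤ; +_; -[1+_])
open import Data.Integer.Divisibility as ℤD using ()
open import Data.Rational as ℚ using (ℚ)
open import Data.Fin using (Fin)
open import Data.Product using (Σ; ∃; ∃-syntax; _×_; _,_)
open import Algebra.Bundles using (AbelianGroup)
open import Relation.Binary.PropositionalEquality using (_≡_)

-- Values in ℚ/ℤ are represented by rationals; x ≡₁ y means x ≡ y (mod 1),
-- i.e. x - y is an integer (its normalised denominator is 1).
_≡₁_ : ℚ → ℚ → Set
x ≡₁ y = ℚ.denominatorℕ (x ℚ.- y) ≡ 1

ι : ℤ → ℚ
ι z = z ℚ./ 1

module _ {c ℓ : Level} (G : AbelianGroup c ℓ) where
  open AbelianGroup G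

  _·ℕ_ : ℕ → Carrier → Carrier
  zero ·ℕ x = ε
  suc n ·ℕ x = x ∙ (n ·ℕ x)

  _·ℤ_ : ℤ → Carrier → Carrier
  (+ n) ·ℤ x = n ·ℕ x
  -[1+ n ] ·ℤ x = (suc n ·ℕ x) ⁻¹

record DiscriminantForm (c ℓ : Level) : Set (lsuc (c ⊔ ℓ)) where
  field
    grp : AbelianGroup c ℓ
  open AbelianGroup grp public
  field
    size       : ℕ
    enum       : Fin size → Carrier
    enum-onto  : ∀ x → ∃[ i ] (enum i ≈ x)
    -- the quadratic form (values read modulo 1)
    q          : Carrier → ℚ
    q-cong     : ∀ {x y} → x ≈ y → q x ≡₁ q y
  B : Carrier → Carrier → ℚ
  B β γ = (q (β ∙ γ) ℚ.- q β) ℚ.- q γ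
  field
    q-scalar   : ∀ (a : ℤ) x → q (_·ℤ_ grp a x) ≡₁ (ι (a ℤ.* a) ℚ.* q x)
    B-additive : ∀ β β′ γ → B (β ∙ β′) γ ≡₁ (B β γ ℚ.+ B β′ γ)
    nondegenerate : ∀ β → (∀ γ → B β γ ≡₁ ℚ.0ℚ) → β ≈ ε

module _ {c ℓ : Level} (D : DiscriminantForm c ℓ) where
  open DiscriminantForm D

  Annihilates : ℕ → Set c
  Annihilates N = ∀ γ → (ι (+ N) ℚ.* q γ) ≡₁ ℚ.0ℚ

  IsLevel : ℕ → Set c
  IsLevel N = 0 < N × Annihilates N × (∀ M → 0 < M → Annihilates M → N ≤ M)

  Perp : Carrier → Carrier → Set
  Perp γ β = B β γ ≡₁ ℚ.0ℚ

  record IsSubgroup (H : Carrier → Set (c ⊔ ℓ)) : Set (c ⊔ ℓ) where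
    field
      resp  : ∀ {x y} → x ≈ y → H x → H y
      has-ε : H ε
      ∙-closed : ∀ {x y} → H x → H y → H (x ∙ y)
      ⁻¹-closed : ∀ {x} → H x → H (x ⁻¹)

  Isotropic : (Carrier → Set (c ⊔ ℓ)) → Set (c ⊔ ℓ)
  Isotropic H = ∀ x → H x → q x ≡₁ ℚ.0ℚ

  -- (ℤ/pℤ)^n is modelled as the setoid of vectors Fin n → ℤ modulo p.
  _≡[mod_]_ : {n : ℕ} → (Fin n → ℤ) → ℕ → (Fin n → ℤ) → Set
  u ≡[mod p ] v = ∀ i → (+ p) ℤD.∣ (u i ℤ.- v i)

  -- H is isomorphic to (ℤ/pℤ)^n: a group homomorphism φ from ℤ^n
  -- with kernel exactly (pℤ)^n and image exactly H.
  record IsoToElemAbelian (H : Carrier → Set (c ⊔ ℓ)) (p n : ℕ) : Set (c ⊔ ℓ) where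
    field
      φ      : (Fin n → ℤ) → Carrier
      φ-hom  : ∀ u v → φ (λ i → u i ℤ.+ v i) ≈ (φ u ∙ φ v)
      φ-ker  : ∀ u v → φ u ≈ φ v → u ≡[mod p ] v
      φ-wd   : ∀ u v → u ≡[mod p ] v → φ u ≈ φ v
      φ-into : ∀ u → H (φ u)
      φ-onto : ∀ x → H x → ∃[ u ] (φ u ≈ x)

-- Let φ : (ℤ/pℤ)³ ≅ H. The functional u ↦ (φ u, γ) on (ℤ/pℤ)³ takes values in
-- (1/p)ℤ/ℤ, so it is u ↦ (a · u)/p for an integer vector a, and its kernel contains
-- two vectors v, w independent mod p. The image of x ↦ φ(x₀ v + x₁ w) is then a copy
-- of (ℤ/pℤ)² inside γ⊥, and it is isotropic because it lies in H.

module Submission where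

open import Defs
open import Level using (Level; _⊔_; Lift; lift)
open import Data.Nat using (ℕ; zero; suc; _^_; NonZero; nonTrivial⇒≢1)
open import Data.Nat.Divisibility using (∣1⇒≡1) renaming (_∣_ to _ℕ∣_)
open import Data.Nat.Primality using (Prime; euclidsLemma; prime⇒nonZero; prime⇒nonTrivial)
open import Data.Nat.Coprimality using (1-coprimeTo) renaming (sym to coprime-sym)
open import Data.Integer as ℤ using (ℤ; +_; -[1+_])
import Data.Integer.Properties as ℤP
open import Data.Integer.Divisibility.Signed using (_∣_; divides; _∣?_; ∣ᵤ⇒∣; ∣⇒∣ᵤ; ∣-refl; ∣m∣n⇒∣m+n; ∣m⇒∣m*n)
open import Data.Integer.Tactic.RingSolver using (solve-∀)
open import Data.Rational as ℚ using (ℚ; mkℚ)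
import Data.Rational.Properties as ℚP
open import Data.Rational.Solver using (module +-*-Solver)
open import Data.Fin using (Fin; zero; suc)
open import Data.Vec.Functional using (_∷_; [])
open import Data.Product using (∃; ∃-syntax; _×_; _,_; proj₁; proj₂)
open import Data.Sum using (inj₁; inj₂)
open import Function using (_∘_; it)
open import Relation.Nullary using (Dec; yes; no; ¬_; contradiction)
open import Relation.Binary.Bundles using (Setoid)
open import Relation.Binary.PropositionalEquality as ≡ using (_≡_; _≗_; refl; cong; cong₂; subst)
import Relation.Binary.Reasoning.Setoid as SetoidReasoning
import Algebra.Properties.Group as GroupProperties

open +-*-Solver using (solve; _:+_; _:-_; _:*_; :-_; _:=_; con)

-- Arithmetic in ℚ/ℤ

ι≡mkℚ : ∀ z → ι z ≡ mkℚ z 0 (coprime-sym (1-coprimeTo _))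
ι≡mkℚ z = ℚP.↥p/↧p≡p (mkℚ z 0 (coprime-sym (1-coprimeTo _)))

ι-+ : ∀ a b → ι (a ℤ.+ b) ≡ ι a ℚ.+ ι b
ι-+ a b rewrite ι≡mkℚ a | ι≡mkℚ b | ℤP.*-identityʳ a | ℤP.*-identityʳ b = refl

ι-* : ∀ a b → ι (a ℤ.* b) ≡ ι a ℚ.* ι b
ι-* a b rewrite ι≡mkℚ a | ι≡mkℚ b = refl

ι-neg : ∀ a → ι (ℤ.- a) ≡ ℚ.- ι a
ι-neg a rewrite ι≡mkℚ a | ι≡mkℚ (ℤ.- a) with a
... | + zero   = refl
... | + suc _  = refl
... | -[1+ _ ] = refl

Integral : ℚ → Set
Integral r = ∃[ z ] r ≡ ι z

integral-ι : ∀ z → Integral (ι z)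
integral-ι z = z , refl

integral-+ : ∀ {r s} → Integral r → Integral s → Integral (r ℚ.+ s)
integral-+ (a , refl) (b , refl) = a ℤ.+ b , ≡.sym (ι-+ a b)

integral-neg : ∀ {r} → Integral r → Integral (ℚ.- r)
integral-neg (a , refl) = ℤ.- a , ≡.sym (ι-neg a)

integral-ι* : ∀ n {r} → Integral r → Integral (ι n ℚ.* r)
integral-ι* n (a , refl) = n ℤ.* a , ≡.sym (ι-* n a)

-- Like _≡₁_, but with the integer difference as evidence.
infix 4 _≈₁_
record _≈₁_ (x y : ℚ) : Set where
  constructor integral-difference
  field integral : Integral (x ℚ.- y)

≡₁⇒≈₁ : ∀ {x y} → x ≡₁ y → x ≈₁ y
≡₁⇒≈₁ {x} {y} = integral-difference ∘ integral (x ℚ.- y)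
  where
  integral : ∀ r → ℚ.denominatorℕ r ≡ 1 → Integral r
  integral (mkℚ n zero _) refl = n , ≡.sym (ℚP.↥p/↧p≡p _)

≈₁⇒≡₁ : ∀ {x y} → x ≈₁ y → x ≡₁ y
≈₁⇒≡₁ (integral-difference (z , eq)) = ≡.trans (cong ℚ.denominatorℕ eq) (cong ℚ.denominatorℕ (ι≡mkℚ z))

≈₁-refl : ∀ {x} → x ≈₁ x
≈₁-refl {x} = integral-difference (+ 0 , solve 1 (λ x → x :- x := con ℚ.0ℚ) refl x)

≈₁-sym : ∀ {x y} → x ≈₁ y → y ≈₁ x
≈₁-sym {x} {y} (integral-difference x-y) = integral-difference
  (subst Integral (solve 2 (λ x y → :- (x :- y) := y :- x) refl x y) (integral-neg x-y))

≈₁-trans : ∀ {x y w} → x ≈₁ y → y ≈₁ w → x ≈₁ w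
≈₁-trans {x} {y} {w} (integral-difference x-y) (integral-difference y-w) = integral-difference
  (subst Integral (solve 3 (λ x y w → (x :- y) :+ (y :- w) := x :- w) refl x y w) (integral-+ x-y y-w))

ℚ/ℤ : Setoid _ _
ℚ/ℤ = record
  { Carrier = ℚ
  ; _≈_ = _≈₁_
  ; isEquivalence = record { refl = ≈₁-refl ; sym = ≈₁-sym ; trans = ≈₁-trans }
  }

ι≈₁0 : ∀ z → ι z ≈₁ ℚ.0ℚ
ι≈₁0 z = integral-difference (subst Integral (solve 1 (λ x → x := x :- con ℚ.0ℚ) refl (ι z)) (integral-ι z))

+-cong₁ : ∀ {x y x′ y′} → x ≈₁ y → x′ ≈₁ y′ → x ℚ.+ x′ ≈₁ y ℚ.+ y′
+-cong₁ {x} {y} {x′} {y′} (integral-difference x-y) (integral-difference x′-y′) = integral-difference (subst Integral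
  (solve 4 (λ x y x′ y′ → (x :- y) :+ (x′ :- y′) := (x :+ x′) :- (y :+ y′)) refl x y x′ y′)
  (integral-+ x-y x′-y′))

-‿cong₁ : ∀ {x y} → x ≈₁ y → ℚ.- x ≈₁ ℚ.- y
-‿cong₁ {x} {y} (integral-difference x-y) = integral-difference
  (subst Integral (solve 2 (λ x y → :- (x :- y) := :- x :- :- y) refl x y) (integral-neg x-y))

ι*-cong₁ : ∀ n {x y} → x ≈₁ y → ι n ℚ.* x ≈₁ ι n ℚ.* y
ι*-cong₁ n {x} {y} (integral-difference x-y) = integral-difference
  (subst Integral (solve 3 (λ n x y → n :* (x :- y) := n :* x :- n :* y) refl (ι n) x y) (integral-ι* n x-y))

≈₁-double⇒≈₁0 : ∀ {x} → x ≈₁ x ℚ.+ x → x ≈₁ ℚ.0ℚ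
≈₁-double⇒≈₁0 {x} (integral-difference d) = integral-difference
  (subst Integral (solve 1 (λ x → :- (x :- (x :+ x)) := x :- con ℚ.0ℚ) refl x) (integral-neg d))

+≈₁0⇒≈₁- : ∀ {x y} → x ℚ.+ y ≈₁ ℚ.0ℚ → x ≈₁ ℚ.- y
+≈₁0⇒≈₁- {x} {y} (integral-difference d) = integral-difference
  (subst Integral (solve 2 (λ x y → (x :+ y) :- con ℚ.0ℚ := x :- (:- y)) refl x y) d)

ι*-cancelˡ : ∀ n {{_ : NonZero n}} {x y} → ι (+ n) ℚ.* x ≡ ι (+ n) ℚ.* y → x ≡ y
ι*-cancelˡ n {x} {y} nx≡ny =
  ≡.trans (≡.sym (inverse-* x)) (≡.trans (cong (ℚ.1/ N ℚ.*_) nx≡ny) (inverse-* y))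
  where
  N : ℚ
  N = ι (+ n)
  instance
    N≢0 : ℚ.NonZero N
    N≢0 = subst ℚ.NonZero (≡.sym (ι≡mkℚ (+ n))) it
  inverse-* : ∀ z → ℚ.1/ N ℚ.* (N ℚ.* z) ≡ z
  inverse-* z = ≡.trans (≡.sym (ℚP.*-assoc (ℚ.1/ N) N z))
    (≡.trans (cong (ℚ._* z) (ℚP.*-inverseˡ N)) (ℚP.*-identityˡ z))

-- Additive maps ℤⁿ → ℚ/ℤ

V : ℕ → Set
V n = Fin n → ℤ

infixl 6 _⊕_
infixl 7 _⊙_

_⊕_ : ∀ {n} → V n → V n → V n
(u ⊕ v) i = u i ℤ.+ v i

_⊙_ : ∀ {n} → ℤ → V n → V n
(a ⊙ u) i = a ℤ.* u i

0v : ∀ {n} → V n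
0v _ = + 0

record IsAdditive {n} (g : V n → ℚ) : Set where
  field
    resp-≗ : ∀ {u v} → u ≗ v → g u ≈₁ g v
    homo-⊕ : ∀ u v → g (u ⊕ v) ≈₁ g u ℚ.+ g v

  open SetoidReasoning ℚ/ℤ

  homo-0v : g 0v ≈₁ ℚ.0ℚ
  homo-0v = ≈₁-double⇒≈₁0 (begin
    g 0v             ≈⟨ resp-≗ (λ _ → refl) ⟩
    g (0v ⊕ 0v)      ≈⟨ homo-⊕ 0v 0v ⟩
    g 0v ℚ.+ g 0v    ∎)

  homo-+⊙ : ∀ k u → g (+ k ⊙ u) ≈₁ ι (+ k) ℚ.* g u
  homo-+⊙ zero u = begin
    g (+ 0 ⊙ u)      ≈⟨ resp-≗ (λ i → ℤP.*-zeroˡ (u i)) ⟩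
    g 0v             ≈⟨ homo-0v ⟩
    ℚ.0ℚ             ≡⟨ ℚP.*-zeroˡ (g u) ⟨
    ℚ.0ℚ ℚ.* g u     ∎
  homo-+⊙ (suc k) u = begin
    g (+ suc k ⊙ u)              ≈⟨ resp-≗ (λ i → 1+m*x≡x+m*x (+ k) (u i)) ⟩
    g (u ⊕ + k ⊙ u)              ≈⟨ homo-⊕ u (+ k ⊙ u) ⟩
    g u ℚ.+ g (+ k ⊙ u)          ≈⟨ +-cong₁ (≈₁-refl {g u}) (homo-+⊙ k u) ⟩
    g u ℚ.+ ι (+ k) ℚ.* g u      ≡⟨ solve 2 (λ x m → x :+ m :* x := (con ℚ.1ℚ :+ m) :* x) refl (g u) (ι (+ k)) ⟩
    (ℚ.1ℚ ℚ.+ ι (+ k)) ℚ.* g u   ≡⟨ cong (ℚ._* g u) (ι-+ (+ 1) (+ k)) ⟨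
    ι (+ suc k) ℚ.* g u          ∎
    where
    1+m*x≡x+m*x : ∀ m x → (+ 1 ℤ.+ m) ℤ.* x ≡ x ℤ.+ m ℤ.* x
    1+m*x≡x+m*x = solve-∀

  homo-⊙ : ∀ a u → g (a ⊙ u) ≈₁ ι a ℚ.* g u
  homo-⊙ (+ k) u = homo-+⊙ k u
  homo-⊙ -[1+ k ] u = begin
    g (-[1+ k ] ⊙ u)              ≈⟨ +≈₁0⇒≈₁- (begin
      g (-[1+ k ] ⊙ u) ℚ.+ g (+ suc k ⊙ u)  ≈⟨ homo-⊕ _ _ ⟨
      g (-[1+ k ] ⊙ u ⊕ + suc k ⊙ u)       ≈⟨ resp-≗ (λ i → -m*x+m*x≡0 (+ suc k) (u i)) ⟩
      g 0v                                 ≈⟨ homo-0v ⟩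
      ℚ.0ℚ                                 ∎) ⟩
    ℚ.- g (+ suc k ⊙ u)           ≈⟨ -‿cong₁ (homo-+⊙ (suc k) u) ⟩
    ℚ.- (ι (+ suc k) ℚ.* g u)     ≡⟨ solve 2 (λ m x → :- (m :* x) := (:- m) :* x) refl (ι (+ suc k)) (g u) ⟩
    ℚ.- ι (+ suc k) ℚ.* g u       ≡⟨ cong (ℚ._* g u) (ι-neg (+ suc k)) ⟨
    ι -[1+ k ] ℚ.* g u            ∎
    where
    -m*x+m*x≡0 : ∀ m x → ℤ.- m ℤ.* x ℤ.+ m ℤ.* x ≡ + 0
    -m*x+m*x≡0 = solve-∀

  vanishes-on-span : ∀ {u v} → g u ≈₁ ℚ.0ℚ → g v ≈₁ ℚ.0ℚ → ∀ a b → g (a ⊙ u ⊕ b ⊙ v) ≈₁ ℚ.0ℚ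
  vanishes-on-span {u} {v} gu≈0 gv≈0 a b = begin
    g (a ⊙ u ⊕ b ⊙ v)                  ≈⟨ homo-⊕ _ _ ⟩
    g (a ⊙ u) ℚ.+ g (b ⊙ v)            ≈⟨ +-cong₁ (homo-⊙ a u) (homo-⊙ b v) ⟩
    ι a ℚ.* g u ℚ.+ ι b ℚ.* g v        ≈⟨ +-cong₁ (ι*-cong₁ a gu≈0) (ι*-cong₁ b gv≈0) ⟩
    ι a ℚ.* ℚ.0ℚ ℚ.+ ι b ℚ.* ℚ.0ℚ
      ≡⟨ solve 2 (λ a b → a :* con ℚ.0ℚ :+ b :* con ℚ.0ℚ := con ℚ.0ℚ) refl (ι a) (ι b) ⟩
    ℚ.0ℚ                               ∎

-- Functionals on ℤ³ killed by p

e : Fin 3 → V 3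
e zero             = + 1 ∷ + 0 ∷ + 0 ∷ []
e (suc zero)       = + 0 ∷ + 1 ∷ + 0 ∷ []
e (suc (suc zero)) = + 0 ∷ + 0 ∷ + 1 ∷ []

infixl 7 _·_
_·_ : V 3 → V 3 → ℤ
a · u = a zero ℤ.* u zero ℤ.+ a (suc zero) ℤ.* u (suc zero) ℤ.+ a (suc (suc zero)) ℤ.* u (suc (suc zero))

basis-expansion : ∀ u →
  u ≗ u zero ⊙ e zero ⊕ u (suc zero) ⊙ e (suc zero) ⊕ u (suc (suc zero)) ⊙ e (suc (suc zero))
basis-expansion u zero             = x≡x*1+y*0+z*0 (u zero) (u (suc zero)) (u (suc (suc zero)))
  where
  x≡x*1+y*0+z*0 : ∀ x y z → x ≡ x ℤ.* + 1 ℤ.+ y ℤ.* + 0 ℤ.+ z ℤ.* + 0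
  x≡x*1+y*0+z*0 = solve-∀
basis-expansion u (suc zero)       = y≡x*0+y*1+z*0 (u zero) (u (suc zero)) (u (suc (suc zero)))
  where
  y≡x*0+y*1+z*0 : ∀ x y z → y ≡ x ℤ.* + 0 ℤ.+ y ℤ.* + 1 ℤ.+ z ℤ.* + 0
  y≡x*0+y*1+z*0 = solve-∀
basis-expansion u (suc (suc zero)) = z≡x*0+y*0+z*1 (u zero) (u (suc zero)) (u (suc (suc zero)))
  where
  z≡x*0+y*0+z*1 : ∀ x y z → z ≡ x ℤ.* + 0 ℤ.+ y ℤ.* + 0 ℤ.+ z ℤ.* + 1
  z≡x*0+y*0+z*1 = solve-∀

linearExtension : (V 3 → ℚ) → V 3 → ℚ
linearExtension g u =
  ι (u zero) ℚ.* g (e zero) ℚ.+ ι (u (suc zero)) ℚ.* g (e (suc zero))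
    ℚ.+ ι (u (suc (suc zero))) ℚ.* g (e (suc (suc zero)))

module _ {g : V 3 → ℚ} (g-additive : IsAdditive g) where
  open IsAdditive g-additive
  open SetoidReasoning ℚ/ℤ

  ≈₁-linearExtension : ∀ u → g u ≈₁ linearExtension g u
  ≈₁-linearExtension u = begin
    g u                              ≈⟨ resp-≗ (basis-expansion u) ⟩
    g (x ⊙ e₀ ⊕ y ⊙ e₁ ⊕ z ⊙ e₂)     ≈⟨ homo-⊕ _ _ ⟩
    g (x ⊙ e₀ ⊕ y ⊙ e₁) ℚ.+ g (z ⊙ e₂)
      ≈⟨ +-cong₁ (homo-⊕ _ _) (homo-⊙ z e₂) ⟩
    g (x ⊙ e₀) ℚ.+ g (y ⊙ e₁) ℚ.+ ι z ℚ.* g e₂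
      ≈⟨ +-cong₁ (+-cong₁ (homo-⊙ x e₀) (homo-⊙ y e₁)) (≈₁-refl {ι z ℚ.* g e₂}) ⟩
    ι x ℚ.* g e₀ ℚ.+ ι y ℚ.* g e₁ ℚ.+ ι z ℚ.* g e₂ ∎
    where
    x y z : ℤ
    x = u zero; y = u (suc zero); z = u (suc (suc zero))
    e₀ e₁ e₂ : V 3
    e₀ = e zero; e₁ = e (suc zero); e₂ = e (suc (suc zero))

module _ {p} {{_ : NonZero p}} {g : V 3 → ℚ} (g-additive : IsAdditive g)
         (g-torsion : ∀ u → ι (+ p) ℚ.* g u ≈₁ ℚ.0ℚ) where

  -- g (e i) ≡ numerators i / p modulo 1
  numerators : V 3
  numerators i = proj₁ (_≈₁_.integral (g-torsion (e i)))

  p*g[e]≡numerator : ∀ i → ι (+ p) ℚ.* g (e i) ≡ ι (numerators i)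
  p*g[e]≡numerator i =
    ≡.trans (solve 1 (λ x → x := x :- con ℚ.0ℚ) refl _) (proj₂ (_≈₁_.integral (g-torsion (e i))))

  p*linearExtension≡numerators· : ∀ u → ι (+ p) ℚ.* linearExtension g u ≡ ι (numerators · u)
  p*linearExtension≡numerators· u = begin
    P ℚ.* (ι x ℚ.* f₀ ℚ.+ ι y ℚ.* f₁ ℚ.+ ι z ℚ.* f₂)
      ≡⟨ solve 7 (λ P x y z f₀ f₁ f₂ → P :* (x :* f₀ :+ y :* f₁ :+ z :* f₂) :=
                    P :* f₀ :* x :+ P :* f₁ :* y :+ P :* f₂ :* z) refl P (ι x) (ι y) (ι z) f₀ f₁ f₂ ⟩
    P ℚ.* f₀ ℚ.* ι x ℚ.+ P ℚ.* f₁ ℚ.* ι y ℚ.+ P ℚ.* f₂ ℚ.* ι z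
      ≡⟨ cong₂ ℚ._+_ (cong₂ ℚ._+_ (cong (ℚ._* ι x) (p*g[e]≡numerator zero))
                                  (cong (ℚ._* ι y) (p*g[e]≡numerator (suc zero))))
                     (cong (ℚ._* ι z) (p*g[e]≡numerator (suc (suc zero)))) ⟩
    ι a₀ ℚ.* ι x ℚ.+ ι a₁ ℚ.* ι y ℚ.+ ι a₂ ℚ.* ι z
      ≡⟨ cong₂ ℚ._+_ (cong₂ ℚ._+_ (ι-* a₀ x) (ι-* a₁ y)) (ι-* a₂ z) ⟨
    ι (a₀ ℤ.* x) ℚ.+ ι (a₁ ℤ.* y) ℚ.+ ι (a₂ ℤ.* z)
      ≡⟨ ≡.trans (ι-+ (a₀ ℤ.* x ℤ.+ a₁ ℤ.* y) (a₂ ℤ.* z))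
                 (cong (ℚ._+ ι (a₂ ℤ.* z)) (ι-+ (a₀ ℤ.* x) (a₁ ℤ.* y))) ⟨
    ι (numerators · u) ∎
    where
    open ≡.≡-Reasoning
    P f₀ f₁ f₂ : ℚ
    P = ι (+ p)
    f₀ = g (e zero); f₁ = g (e (suc zero)); f₂ = g (e (suc (suc zero)))
    x y z a₀ a₁ a₂ : ℤ
    x = u zero; y = u (suc zero); z = u (suc (suc zero))
    a₀ = numerators zero; a₁ = numerators (suc zero); a₂ = numerators (suc (suc zero))

  vanishes-on-kernel : ∀ u → + p ∣ numerators · u → g u ≈₁ ℚ.0ℚ
  vanishes-on-kernel u (divides m a·u≡m*p) = begin
    g u                  ≈⟨ ≈₁-linearExtension g-additive u ⟩
    linearExtension g u  ≡⟨ ι*-cancelˡ p (≡.trans (p*linearExtension≡numerators· u) ι[a·u]≡p*m) ⟩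
    ι m                  ≈⟨ ι≈₁0 m ⟩
    ℚ.0ℚ                 ∎
    where
    open SetoidReasoning ℚ/ℤ
    ι[a·u]≡p*m : ι (numerators · u) ≡ ι (+ p) ℚ.* ι m
    ι[a·u]≡p*m = ≡.trans (cong ι a·u≡m*p) (≡.trans (ι-* m (+ p)) (ℚP.*-comm (ι m) (ι (+ p))))

-- Independent vectors in the kernel of a functional on 𝔽ₚ³

Independent : ℕ → V 3 → V 3 → Set
Independent p v w = ∀ x y → (∀ i → + p ∣ x ℤ.* v i ℤ.+ y ℤ.* w i) → + p ∣ x × + p ∣ y

record KernelPair (p : ℕ) (a : V 3) : Set where
  field
    v w         : V 3
    v-ker       : + p ∣ a · v
    w-ker       : + p ∣ a · w
    independent : Independent p v w

≡0⇒∣ : ∀ p {z} → z ≡ + 0 → + p ∣ z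
≡0⇒∣ p refl = divides (+ 0) refl

a·e≡a : ∀ a i → a · e i ≡ a i
a·e≡a a zero             = ≡.sym (basis-expansion a zero)
a·e≡a a (suc zero)       = ≡.sym (basis-expansion a (suc zero))
a·e≡a a (suc (suc zero)) = ≡.sym (basis-expansion a (suc (suc zero)))

module _ {p} (p-prime : Prime p) where

  p∤1 : ¬ + p ∣ + 1
  p∤1 p∣1 = nonTrivial⇒≢1 {{prime⇒nonTrivial p-prime}} (∣1⇒≡1 (∣⇒∣ᵤ p∣1))

  ∣m*n∧∤n⇒∣m : ∀ {x a} → ¬ + p ∣ a → + p ∣ x ℤ.* a → + p ∣ x
  ∣m*n∧∤n⇒∣m {x} {a} p∤a p∣xa
    with euclidsLemma ℤ.∣ x ∣ ℤ.∣ a ∣ p-prime (subst (p ℕ∣_) (ℤP.abs-* x a) (∣⇒∣ᵤ p∣xa))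
  ... | inj₁ p∣x = ∣ᵤ⇒∣ p∣x
  ... | inj₂ p∣a = contradiction (∣ᵤ⇒∣ p∣a) p∤a

  pivots⇒independent : ∀ {v w} i j → ¬ + p ∣ v i → w i ≡ + 0 → v j ≡ + 0 → ¬ + p ∣ w j → Independent p v w
  pivots⇒independent {v} {w} i j p∤vi wi≡0 vj≡0 p∤wj x y p∣combination =
      ∣m*n∧∤n⇒∣m p∤vi (subst (+ p ∣_) (drop-right x (v i) y wi≡0) (p∣combination i))
    , ∣m*n∧∤n⇒∣m p∤wj (subst (+ p ∣_) (drop-left x y (w j) vj≡0) (p∣combination j))
    where
    drop-right : ∀ x c y {d} → d ≡ + 0 → x ℤ.* c ℤ.+ y ℤ.* d ≡ x ℤ.* c
    drop-right x c y refl = x*c+y*0≡x*c x c y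
      where
      x*c+y*0≡x*c : ∀ x c y → x ℤ.* c ℤ.+ y ℤ.* + 0 ≡ x ℤ.* c
      x*c+y*0≡x*c = solve-∀
    drop-left : ∀ x y d {c} → c ≡ + 0 → x ℤ.* c ℤ.+ y ℤ.* d ≡ y ℤ.* d
    drop-left x y d refl = x*0+y*d≡y*d x y d
      where
      x*0+y*d≡y*d : ∀ x y d → x ℤ.* + 0 ℤ.+ y ℤ.* d ≡ y ℤ.* d
      x*0+y*d≡y*d = solve-∀

  kernelPair : ∀ a → KernelPair p a
  kernelPair a = byPivots (+ p ∣? a₀) (+ p ∣? a₁)
    where
    a₀ a₁ a₂ : ℤ
    a₀ = a zero; a₁ = a (suc zero); a₂ = a (suc (suc zero))

    x*-y+y*x+z*0≡0 : ∀ x y z → x ℤ.* ℤ.- y ℤ.+ y ℤ.* x ℤ.+ z ℤ.* + 0 ≡ + 0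
    x*-y+y*x+z*0≡0 = solve-∀
    x*-z+y*0+z*x≡0 : ∀ x y z → x ℤ.* ℤ.- z ℤ.+ y ℤ.* + 0 ℤ.+ z ℤ.* x ≡ + 0
    x*-z+y*0+z*x≡0 = solve-∀
    x*0+y*-z+z*y≡0 : ∀ x y z → x ℤ.* + 0 ℤ.+ y ℤ.* ℤ.- z ℤ.+ z ℤ.* y ≡ + 0
    x*0+y*-z+z*y≡0 = solve-∀

    byPivots : Dec (+ p ∣ a₀) → Dec (+ p ∣ a₁) → KernelPair p a
    byPivots (no p∤a₀) _ = record
      { v           = ℤ.- a₁ ∷ a₀ ∷ + 0 ∷ []
      ; w           = ℤ.- a₂ ∷ + 0 ∷ a₀ ∷ []
      ; v-ker       = ≡0⇒∣ p (x*-y+y*x+z*0≡0 a₀ a₁ a₂)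
      ; w-ker       = ≡0⇒∣ p (x*-z+y*0+z*x≡0 a₀ a₁ a₂)
      ; independent = pivots⇒independent (suc zero) (suc (suc zero)) p∤a₀ refl refl p∤a₀
      }
    byPivots (yes p∣a₀) (no p∤a₁) = record
      { v           = e zero
      ; w           = + 0 ∷ ℤ.- a₂ ∷ a₁ ∷ []
      ; v-ker       = subst (+ p ∣_) (≡.sym (a·e≡a a zero)) p∣a₀
      ; w-ker       = ≡0⇒∣ p (x*0+y*-z+z*y≡0 a₀ a₁ a₂)
      ; independent = pivots⇒independent zero (suc (suc zero)) p∤1 refl refl p∤a₁
      }
    byPivots (yes p∣a₀) (yes p∣a₁) = record
      { v           = e zero
      ; w           = e (suc zero)
      ; v-ker       = subst (+ p ∣_) (≡.sym (a·e≡a a zero)) p∣a₀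
      ; w-ker       = subst (+ p ∣_) (≡.sym (a·e≡a a (suc zero))) p∣a₁
      ; independent = pivots⇒independent zero (suc zero) p∤1 refl refl p∤1
      }

-- Homomorphisms from (ℤ/pℤ)ⁿ into a discriminant form

module _ {c ℓ} (D : DiscriminantForm c ℓ) where
  open DiscriminantForm D renaming (refl to ≈-refl; sym to ≈-sym; trans to ≈-trans)
  open GroupProperties group using (identityˡ-unique; inverseʳ-unique)

  q-cong₁ : ∀ {x y} → x ≈ y → q x ≈₁ q y
  q-cong₁ {x} {y} x≈y = ≡₁⇒≈₁ {q x} {q y} (q-cong x≈y)

  B-congˡ : ∀ {x y} γ → x ≈ y → B x γ ≈₁ B y γ
  B-congˡ γ x≈y = +-cong₁ (+-cong₁ (q-cong₁ (∙-cong x≈y ≈-refl)) (-‿cong₁ (q-cong₁ x≈y))) (≈₁-refl {ℚ.- q γ})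

  ≡[mod]⇒∣ : ∀ {n p} (u v : V n) → _≡[mod_]_ D u p v → ∀ i → + p ∣ u i ℤ.- v i
  ≡[mod]⇒∣ {p = p} u v u≡v i = ∣ᵤ⇒∣ {+ p} {u i ℤ.- v i} (u≡v i)

  ∣⇒≡[mod] : ∀ {n p} (u v : V n) → (∀ i → + p ∣ u i ℤ.- v i) → _≡[mod_]_ D u p v
  ∣⇒≡[mod] u v p∣u-v i = ∣⇒∣ᵤ (p∣u-v i)

  ≗⇒≡[mod] : ∀ {n p} {u v : V n} → u ≗ v → _≡[mod_]_ D u p v
  ≗⇒≡[mod] {p = p} {u} {v} u≗v = ∣⇒≡[mod] u v λ i →
    ≡0⇒∣ p (≡.trans (cong (ℤ._- v i) (u≗v i)) (ℤP.+-inverseʳ (v i)))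

  module Homomorphism {n p} (ψ : V n → Carrier)
    (ψ-hom : ∀ u v → ψ (u ⊕ v) ≈ ψ u ∙ ψ v)
    (ψ-wd : ∀ u v → _≡[mod_]_ D u p v → ψ u ≈ ψ v) where

    ψ-resp-≗ : ∀ {u v} → u ≗ v → ψ u ≈ ψ v
    ψ-resp-≗ u≗v = ψ-wd _ _ (≗⇒≡[mod] u≗v)

    ψ-0v : ψ 0v ≈ ε
    ψ-0v = identityˡ-unique (ψ 0v) (ψ 0v) (≈-trans (≈-sym (ψ-hom 0v 0v)) (ψ-resp-≗ λ _ → refl))

    ψ-neg : ∀ u → ψ (ℤ.-1ℤ ⊙ u) ≈ ψ u ⁻¹
    ψ-neg u = inverseʳ-unique (ψ u) (ψ (ℤ.-1ℤ ⊙ u))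
      (≈-trans (≈-sym (ψ-hom u _)) (≈-trans (ψ-resp-≗ (λ i → x+-1*x≡0 (u i))) ψ-0v))
      where
      x+-1*x≡0 : ∀ x → x ℤ.+ ℤ.-1ℤ ℤ.* x ≡ + 0
      x+-1*x≡0 = solve-∀

    pairing-isAdditive : ∀ γ → IsAdditive (λ u → B (ψ u) γ)
    pairing-isAdditive γ = record
      { resp-≗ = B-congˡ γ ∘ ψ-resp-≗
      ; homo-⊕ = λ u v →
          ≈₁-trans (B-congˡ γ (ψ-hom u v)) (≡₁⇒≈₁ {B (ψ u ∙ ψ v) γ} (B-additive (ψ u) (ψ v) γ))
      }

    pairing-torsion : ∀ γ u → ι (+ p) ℚ.* B (ψ u) γ ≈₁ ℚ.0ℚ
    pairing-torsion γ u = begin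
      ι (+ p) ℚ.* B (ψ u) γ   ≈⟨ homo-⊙ (+ p) u ⟨
      B (ψ (+ p ⊙ u)) γ       ≈⟨ B-congˡ γ (ψ-wd _ _ p⊙u≡0) ⟩
      B (ψ 0v) γ              ≈⟨ homo-0v ⟩
      ℚ.0ℚ                    ∎
      where
      open IsAdditive (pairing-isAdditive γ)
      open SetoidReasoning ℚ/ℤ
      p⊙u≡0 : _≡[mod_]_ D (+ p ⊙ u) p 0v
      p⊙u≡0 = ∣⇒≡[mod] (+ p ⊙ u) 0v λ i →
        subst (+ p ∣_) (≡.sym (ℤP.+-identityʳ (+ p ℤ.* u i))) (∣m⇒∣m*n (u i) ∣-refl)

    Image : Carrier → Set (c ⊔ ℓ)
    Image x = Lift c (∃[ u ] ψ u ≈ x)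

    image-isSubgroup : IsSubgroup D Image
    image-isSubgroup = record
      { resp      = λ { x≈y (lift (u , ψu≈x)) → lift (u , ≈-trans ψu≈x x≈y) }
      ; has-ε     = lift (0v , ψ-0v)
      ; ∙-closed  = λ { (lift (u , ψu≈x)) (lift (v , ψv≈y)) →
                        lift (u ⊕ v , ≈-trans (ψ-hom u v) (∙-cong ψu≈x ψv≈y)) }
      ; ⁻¹-closed = λ { (lift (u , ψu≈x)) → lift (ℤ.-1ℤ ⊙ u , ≈-trans (ψ-neg u) (⁻¹-cong ψu≈x)) }
      }

    image-isoToElemAbelian : (∀ u v → ψ u ≈ ψ v → _≡[mod_]_ D u p v) → IsoToElemAbelian D Image p n
    image-isoToElemAbelian ψ-ker = record
      { φ      = ψ
      ; φ-hom  = ψ-hom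
      ; φ-ker  = ψ-ker
      ; φ-wd   = ψ-wd
      ; φ-into = λ u → lift (u , ≈-refl)
      ; φ-onto = λ { x (lift ψu≈x) → ψu≈x }
      }

-- An isotropic (ℤ/pℤ)² inside γ⊥

module _ {c ℓ} {D : DiscriminantForm c ℓ} {p} (p-prime : Prime p) (γ : DiscriminantForm.Carrier D)
         {H} (H-isSubgroup : IsSubgroup D H) (H-isotropic : Isotropic D H) (H≅ℤ/p³ : IsoToElemAbelian D H p 3) where
  open DiscriminantForm D renaming (refl to ≈-refl; sym to ≈-sym; trans to ≈-trans)
  open IsoToElemAbelian H≅ℤ/p³
  open Homomorphism D φ φ-hom φ-wd using (pairing-isAdditive; pairing-torsion)

  private instance
    p≢0 : NonZero p
    p≢0 = prime⇒nonZero p-prime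

  a : V 3
  a = numerators {p = p} (pairing-isAdditive γ) (pairing-torsion γ)

  pairing-vanishes-on-kernel : ∀ u → + p ∣ a · u → B (φ u) γ ≈₁ ℚ.0ℚ
  pairing-vanishes-on-kernel = vanishes-on-kernel (pairing-isAdditive γ) (pairing-torsion γ)

  open KernelPair (kernelPair p-prime a)

  combine : V 2 → V 3
  combine x = x zero ⊙ v ⊕ x (suc zero) ⊙ w

  combine-⊕ : ∀ x y → combine (x ⊕ y) ≗ combine x ⊕ combine y
  combine-⊕ x y i = distrib (x zero) (x (suc zero)) (y zero) (y (suc zero)) (v i) (w i)
    where
    distrib : ∀ x₀ x₁ y₀ y₁ c d →
      (x₀ ℤ.+ y₀) ℤ.* c ℤ.+ (x₁ ℤ.+ y₁) ℤ.* d ≡ (x₀ ℤ.* c ℤ.+ x₁ ℤ.* d) ℤ.+ (y₀ ℤ.* c ℤ.+ y₁ ℤ.* d)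
    distrib = solve-∀

  combine-difference : ∀ x y i →
    combine x i ℤ.- combine y i ≡ (x zero ℤ.- y zero) ℤ.* v i ℤ.+ (x (suc zero) ℤ.- y (suc zero)) ℤ.* w i
  combine-difference x y i = distrib (x zero) (x (suc zero)) (y zero) (y (suc zero)) (v i) (w i)
    where
    distrib : ∀ x₀ x₁ y₀ y₁ c d →
      (x₀ ℤ.* c ℤ.+ x₁ ℤ.* d) ℤ.- (y₀ ℤ.* c ℤ.+ y₁ ℤ.* d) ≡ (x₀ ℤ.- y₀) ℤ.* c ℤ.+ (x₁ ℤ.- y₁) ℤ.* d
    distrib = solve-∀

  ψ : V 2 → Carrier
  ψ = φ ∘ combine

  ψ-hom : ∀ x y → ψ (x ⊕ y) ≈ ψ x ∙ ψ y
  ψ-hom x y = ≈-trans (φ-wd _ _ (≗⇒≡[mod] D (combine-⊕ x y))) (φ-hom (combine x) (combine y))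

  ψ-wd : ∀ x y → _≡[mod_]_ D x p y → ψ x ≈ ψ y
  ψ-wd x y x≡y = φ-wd _ _ (∣⇒≡[mod] D (combine x) (combine y) λ i →
    subst (+ p ∣_) (≡.sym (combine-difference x y i))
      (∣m∣n⇒∣m+n (∣m⇒∣m*n (v i) (≡[mod]⇒∣ D x y x≡y zero)) (∣m⇒∣m*n (w i) (≡[mod]⇒∣ D x y x≡y (suc zero)))))

  ψ-ker : ∀ x y → ψ x ≈ ψ y → _≡[mod_]_ D x p y
  ψ-ker x y ψx≈ψy = ∣⇒≡[mod] D x y λ where
      zero       → proj₁ p∣differences
      (suc zero) → proj₂ p∣differences
    where
    p∣differences : + p ∣ x zero ℤ.- y zero × + p ∣ x (suc zero) ℤ.- y (suc zero)
    p∣differences = independent (x zero ℤ.- y zero) (x (suc zero) ℤ.- y (suc zero)) λ i →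
      subst (+ p ∣_) (combine-difference x y i)
        (≡[mod]⇒∣ D (combine x) (combine y) (φ-ker (combine x) (combine y) ψx≈ψy) i)

  open Homomorphism D ψ ψ-hom ψ-wd using (Image; image-isSubgroup; image-isoToElemAbelian)

  image-perp : ∀ β → Image β → Perp D γ β
  image-perp β (lift (x , ψx≈β)) = ≈₁⇒≡₁ (≈₁-trans (B-congˡ D γ (≈-sym ψx≈β))
    (IsAdditive.vanishes-on-span (pairing-isAdditive γ)
      (pairing-vanishes-on-kernel v v-ker) (pairing-vanishes-on-kernel w w-ker) (x zero) (x (suc zero))))

  image-isotropic : Isotropic D Image
  image-isotropic β (lift (x , ψx≈β)) = H-isotropic β (IsSubgroup.resp H-isSubgroup ψx≈β (φ-into (combine x)))

  isotropicPlaneInPerp :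
    ∃[ K ] (IsSubgroup D K × (∀ β → K β → Perp D γ β) × Isotropic D K × IsoToElemAbelian D K p 2)
  isotropicPlaneInPerp = Image , image-isSubgroup , image-perp , image-isotropic , image-isoToElemAbelian ψ-ker

mainTheorem8 : {c ℓ : Level} (p : ℕ) → Prime p → (D : DiscriminantForm c ℓ)
    → (∃[ k ] IsLevel D (p ^ k))
    → (∃[ H ] (IsSubgroup D H × Isotropic D H × IsoToElemAbelian D H p 3))
    → ∀ γ → ∃[ H ] (IsSubgroup D H × (∀ β → H β → Perp D γ β) × Isotropic D H × IsoToElemAbelian D H p 2)
mainTheorem8 p p-prime D _ (H , H-isSubgroup , H-isotropic , H≅ℤ/p³) γ =
  isotropicPlaneInPerp p-prime γ H-isSubgroup H-isotropic H≅ℤ/p³
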